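{- Let $j\ge1$ have binary expansion $j=2^{p_1}+\cdots+2^{p_r}$ with $0\le p_1<\cdots<p_r$, and for each $I\subseteq\{1,\dots,r\}$ let $j_I=\sum_{i\in I}2^{p_i}$. Then for each $a\in\{0,1\}$, $$\bigoplus_{I\subseteq\{1,\dots,r\}}S_a(a^{j+1})^{j_I}\left(0^{j}1\right)=10^{j},$$ where $\bigoplus$ is letterwise XOR of words of length $j+1$ and $S_a(a^{j+1})^{m}$ is the $m$-fold composition.
   Context: For words $w=w_1\cdots w_\ell$, $u=u_1\cdots u_\ell$ over $\{0,1\}$ and $a\in\{0,1\}$, $S_a(w)(u)\in\{0,1\}^\ell$ is the word with $\ell$-th letter $u_\ell$ and $i$-th letter $u_i\oplus(u_{i+1}\wedge[w_{i+1}=a])$ for $1\le i\le\ell-1$ ($[\cdot]$ the indicator; $\oplus,\wedge$ XOR/AND). $a^{j+1}$ is the word of $j+1$ copies of $a$; $S_a(w)^0$ is the identity. -}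

module Defs where

open import Data.Bool using (Bool; true; false; _xor_; _∧_; if_then_else_)
open import Data.Nat using (ℕ; zero; suc; _+_; _^_; _<_)
open import Data.List using (List; []; _∷_; map; _++_; foldr)
open import Data.Nat.ListAction using (sum)
open import Data.Vec using (Vec; []; _∷_; replicate; zipWith)

-- Letters are Bool (false = 0, true = 1).

eqb : Bool → Bool → Bool
eqb true  true  = true
eqb false false = true
eqb _     _     = false

S : ∀ {ℓ} → Bool → Vec Bool ℓ → Vec Bool ℓ → Vec Bool ℓ
S a []           []           = []
S a (w ∷ [])     (u ∷ [])     = u ∷ []
S a (w ∷ w' ∷ ws) (u ∷ u' ∷ us) =
  (u xor (u' ∧ eqb w' a)) ∷ S a (w' ∷ ws) (u' ∷ us)

iter : ∀ {A : Set} → ℕ → (A → A) → A → A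
iter zero    f x = x
iter (suc m) f x = f (iter m f x)

xorW : ∀ {ℓ} → Vec Bool ℓ → Vec Bool ℓ → Vec Bool ℓ
xorW = zipWith _xor_

bigXor : ∀ {ℓ} → List (Vec Bool ℓ) → Vec Bool ℓ
bigXor {ℓ} = foldr xorW (replicate ℓ false)

-- all sub-lists of a list (one per subset of positions; 2^r of them)
subsets : ∀ {A : Set} → List A → List (List A)
subsets []       = [] ∷ []
subsets (x ∷ xs) = map (x ∷_) (subsets xs) ++ subsets xs

data Increasing : List ℕ → Set where
  inc[]  : Increasing []
  inc[-] : ∀ {p} → Increasing (p ∷ [])
  inc∷   : ∀ {p q ps} → p < q → Increasing (q ∷ ps) → Increasing (p ∷ q ∷ ps)

sumPow2 : List ℕ → ℕ
sumPow2 ps = sum (map (2 ^_) ps)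

zeros-one : (j : ℕ) → Vec Bool (suc j)
zeros-one zero    = true ∷ []
zeros-one (suc j) = false ∷ zeros-one j

one-zeros : (j : ℕ) → Vec Bool (suc j)
one-zeros j = true ∷ replicate j false

-- Over GF(2) the map S_a(a^ℓ) is 1 + N, where N is the left shift u ↦ u₂⋯u_ℓ0.
-- Squaring in characteristic 2 gives (1 + N)^(2^p) = 1 + N^(2^p), so the XOR over
-- I ⊆ {1,…,r} of (1 + N)^(j_I) factors as ∏ᵢ (1 + (1 + N)^(2^pᵢ)) = ∏ᵢ N^(2^pᵢ) = N^j,
-- and N^j moves the 1 of 0^j1 to the front.
module Submission where

open import Defs
open import Data.Bool using (Bool; true; false; _xor_; _∧_)
open import Data.Bool.Properties using (xor-assoc; xor-comm; xor-same; xor-identityʳ; ∧-identityʳ)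
open import Data.Nat using (ℕ; zero; suc; _+_; _*_; _^_; _≥_)
open import Data.Nat.Properties using (*-suc; *-zeroʳ)
open import Data.List using (List; []; _∷_; map; _++_; foldr)
open import Data.List.Properties using (map-++; map-cong; map-∘)
open import Data.Vec using (Vec; []; _∷_; replicate; zipWith; _∷ʳ_)
open import Data.Vec.Relation.Binary.Pointwise.Inductive
  using (Pointwise-≡⇒≡; zipWith-assoc; zipWith-comm; zipWith-identityˡ)
open import Relation.Binary.PropositionalEquality
  using (_≡_; _≗_; refl; sym; trans; cong; cong₂; module ≡-Reasoning)
open ≡-Reasoning

iter-+ : ∀ {A : Set} m n (f : A → A) x → iter (m + n) f x ≡ iter m f (iter n f x)
iter-+ zero    n f x = refl
iter-+ (suc m) n f x = cong f (iter-+ m n f x)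

iter-* : ∀ {A : Set} m n (f : A → A) x → iter (m * n) f x ≡ iter n (iter m f) x
iter-* m zero    f x = cong (λ k → iter k f x) (*-zeroʳ m)
iter-* m (suc n) f x = begin
  iter (m * suc n) f x          ≡⟨ cong (λ k → iter k f x) (*-suc m n) ⟩
  iter (m + m * n) f x          ≡⟨ iter-+ m (m * n) f x ⟩
  iter m f (iter (m * n) f x)   ≡⟨ cong (iter m f) (iter-* m n f x) ⟩
  iter m f (iter n (iter m f) x) ∎

iter-cong : ∀ {A : Set} {f g : A → A} → f ≗ g → ∀ k → iter k f ≗ iter k g
iter-cong f≗g zero    x = refl
iter-cong {g = g} f≗g (suc k) x = trans (f≗g _) (cong g (iter-cong f≗g k x))

iter-intertwine : ∀ {A B : Set} {f : A → A} {g : B → B} {h : A → B} →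
                  (∀ x → g (h x) ≡ h (f x)) → ∀ k x → iter k g (h x) ≡ h (iter k f x)
iter-intertwine gh≡hf zero    x = refl
iter-intertwine {g = g} gh≡hf (suc k) x = trans (cong g (iter-intertwine gh≡hf k x)) (gh≡hf _)

module BooleanGroup
  {A : Set} (_⊕_ : A → A → A) (ε : A)
  (⊕-assoc : ∀ x y z → (x ⊕ y) ⊕ z ≡ x ⊕ (y ⊕ z))
  (⊕-comm : ∀ x y → x ⊕ y ≡ y ⊕ x)
  (⊕-identityˡ : ∀ x → ε ⊕ x ≡ x)
  (⊕-same : ∀ x → x ⊕ x ≡ ε)
  where

  ⊕-identityʳ : ∀ x → x ⊕ ε ≡ x
  ⊕-identityʳ x = trans (⊕-comm x ε) (⊕-identityˡ x)

  ⊕-cancelˡ : ∀ x y → x ⊕ (x ⊕ y) ≡ y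
  ⊕-cancelˡ x y = begin
    x ⊕ (x ⊕ y)  ≡⟨ sym (⊕-assoc x x y) ⟩
    (x ⊕ x) ⊕ y  ≡⟨ cong (_⊕ y) (⊕-same x) ⟩
    ε ⊕ y        ≡⟨ ⊕-identityˡ y ⟩
    y            ∎

  ⊕-interchange : ∀ w x y z → (w ⊕ x) ⊕ (y ⊕ z) ≡ (w ⊕ y) ⊕ (x ⊕ z)
  ⊕-interchange w x y z = begin
    (w ⊕ x) ⊕ (y ⊕ z)  ≡⟨ ⊕-assoc w x (y ⊕ z) ⟩
    w ⊕ (x ⊕ (y ⊕ z))  ≡⟨ cong (w ⊕_) (sym (⊕-assoc x y z)) ⟩
    w ⊕ ((x ⊕ y) ⊕ z)  ≡⟨ cong (λ t → w ⊕ (t ⊕ z)) (⊕-comm x y) ⟩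
    w ⊕ ((y ⊕ x) ⊕ z)  ≡⟨ cong (w ⊕_) (⊕-assoc y x z) ⟩
    w ⊕ (y ⊕ (x ⊕ z))  ≡⟨ sym (⊕-assoc w y (x ⊕ z)) ⟩
    (w ⊕ y) ⊕ (x ⊕ z)  ∎

  ⨁ : List A → A
  ⨁ = foldr _⊕_ ε

  ⨁-++ : ∀ xs ys → ⨁ (xs ++ ys) ≡ ⨁ xs ⊕ ⨁ ys
  ⨁-++ []       ys = sym (⊕-identityˡ (⨁ ys))
  ⨁-++ (x ∷ xs) ys = trans (cong (x ⊕_) (⨁-++ xs ys)) (sym (⊕-assoc x (⨁ xs) (⨁ ys)))

  Additive : (A → A) → Set
  Additive f = ∀ x y → f (x ⊕ y) ≡ f x ⊕ f y

  additive-ε : ∀ {f} → Additive f → f ε ≡ ε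
  additive-ε {f} f-add = begin
    f ε          ≡⟨ cong f (sym (⊕-same ε)) ⟩
    f (ε ⊕ ε)    ≡⟨ f-add ε ε ⟩
    f ε ⊕ f ε    ≡⟨ ⊕-same (f ε) ⟩
    ε            ∎

  additive-⨁ : ∀ {f} → Additive f → ∀ xs → f (⨁ xs) ≡ ⨁ (map f xs)
  additive-⨁ f-add []       = additive-ε f-add
  additive-⨁ f-add (x ∷ xs) = trans (f-add x (⨁ xs)) (cong (_ ⊕_) (additive-⨁ f-add xs))

  iter-additive : ∀ {f} → Additive f → ∀ k → Additive (iter k f)
  iter-additive f-add zero    x y = refl
  iter-additive {f} f-add (suc k) x y = trans (cong f (iter-additive f-add k x y)) (f-add _ _)

  1⊕_ : (A → A) → A → A
  (1⊕ N) x = x ⊕ N x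

  1⊕-additive : ∀ {N} → Additive N → Additive (1⊕ N)
  1⊕-additive {N} N-add x y = begin
    (x ⊕ y) ⊕ N (x ⊕ y)      ≡⟨ cong ((x ⊕ y) ⊕_) (N-add x y) ⟩
    (x ⊕ y) ⊕ (N x ⊕ N y)    ≡⟨ ⊕-interchange x y (N x) (N y) ⟩
    (x ⊕ N x) ⊕ (y ⊕ N y)    ∎

  1⊕-square : ∀ {N} → Additive N → iter 2 (1⊕ N) ≗ 1⊕ iter 2 N
  1⊕-square {N} N-add x = begin
    (x ⊕ N x) ⊕ N (x ⊕ N x)        ≡⟨ cong ((x ⊕ N x) ⊕_) (N-add x (N x)) ⟩
    (x ⊕ N x) ⊕ (N x ⊕ N (N x))    ≡⟨ ⊕-assoc x (N x) _ ⟩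
    x ⊕ (N x ⊕ (N x ⊕ N (N x)))    ≡⟨ cong (x ⊕_) (⊕-cancelˡ (N x) (N (N x))) ⟩
    x ⊕ N (N x)                    ∎

  1⊕-pow2 : ∀ {N} → Additive N → ∀ p → iter (2 ^ p) (1⊕ N) ≗ 1⊕ iter (2 ^ p) N
  1⊕-pow2 N-add zero    x = refl
  1⊕-pow2 {N} N-add (suc p) x = begin
    iter (2 * 2 ^ p) (1⊕ N) x           ≡⟨ iter-* 2 (2 ^ p) (1⊕ N) x ⟩
    iter (2 ^ p) (iter 2 (1⊕ N)) x      ≡⟨ iter-cong (1⊕-square N-add) (2 ^ p) x ⟩
    iter (2 ^ p) (1⊕ iter 2 N) x        ≡⟨ 1⊕-pow2 (iter-additive N-add 2) p x ⟩
    (1⊕ iter (2 ^ p) (iter 2 N)) x      ≡⟨ cong (x ⊕_) (sym (iter-* 2 (2 ^ p) N x)) ⟩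
    (1⊕ iter (2 * 2 ^ p) N) x           ∎

  ⨁-subsets-1⊕ : ∀ {N} → Additive N → ∀ ps x →
                 ⨁ (map (λ I → iter (sumPow2 I) (1⊕ N) x) (subsets ps)) ≡ iter (sumPow2 ps) N x
  ⨁-subsets-1⊕ N-add []       x = ⊕-identityʳ x
  ⨁-subsets-1⊕ {N} N-add (p ∷ ps) x = begin
    ⨁ (map g (map (p ∷_) Is ++ Is))              ≡⟨ cong ⨁ (map-++ g (map (p ∷_) Is) Is) ⟩
    ⨁ (map g (map (p ∷_) Is) ++ map g Is)         ≡⟨ ⨁-++ (map g (map (p ∷_) Is)) (map g Is) ⟩
    ⨁ (map g (map (p ∷_) Is)) ⊕ X                 ≡⟨ cong (_⊕ X) ⨁-with-p ⟩
    iter k (1⊕ N) X ⊕ X                           ≡⟨ cong (_⊕ X) (1⊕-pow2 N-add p X) ⟩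
    (X ⊕ iter k N X) ⊕ X                          ≡⟨ ⊕-comm (X ⊕ iter k N X) X ⟩
    X ⊕ (X ⊕ iter k N X)                          ≡⟨ ⊕-cancelˡ X (iter k N X) ⟩
    iter k N X                                    ≡⟨ cong (iter k N) (⨁-subsets-1⊕ N-add ps x) ⟩
    iter k N (iter (sumPow2 ps) N x)              ≡⟨ sym (iter-+ k (sumPow2 ps) N x) ⟩
    iter (k + sumPow2 ps) N x                     ∎
    where
    k = 2 ^ p
    Is = subsets ps
    g : List ℕ → A
    g I = iter (sumPow2 I) (1⊕ N) x
    X = ⨁ (map g Is)

    ⨁-with-p : ⨁ (map g (map (p ∷_) Is)) ≡ iter k (1⊕ N) X
    ⨁-with-p = begin
      ⨁ (map g (map (p ∷_) Is))         ≡⟨ cong ⨁ (sym (map-∘ Is)) ⟩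
      ⨁ (map (λ I → iter (k + sumPow2 I) (1⊕ N) x) Is)
        ≡⟨ cong ⨁ (map-cong (λ I → iter-+ k (sumPow2 I) (1⊕ N) x) Is) ⟩
      ⨁ (map (λ I → iter k (1⊕ N) (g I)) Is) ≡⟨ cong ⨁ (map-∘ Is) ⟩
      ⨁ (map (iter k (1⊕ N)) (map g Is))
        ≡⟨ sym (additive-⨁ (iter-additive (1⊕-additive N-add) k) (map g Is)) ⟩
      iter k (1⊕ N) X                     ∎

xorW-same : ∀ {ℓ} (u : Vec Bool ℓ) → xorW u u ≡ replicate ℓ false
xorW-same []       = refl
xorW-same (x ∷ u) = cong₂ _∷_ (xor-same x) (xorW-same u)

module WordGroup (ℓ : ℕ) = BooleanGroup {Vec Bool ℓ} xorW (replicate ℓ false)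
  (λ u v w → Pointwise-≡⇒≡ (zipWith-assoc xor-assoc u v w))
  (λ u v → Pointwise-≡⇒≡ (zipWith-comm xor-comm u v))
  (λ u → Pointwise-≡⇒≡ (zipWith-identityˡ (λ _ → refl) u))
  xorW-same

zipWith-∷ʳ : ∀ {A B C : Set} {n} (f : A → B → C) (xs : Vec A n) (ys : Vec B n) x y →
             zipWith f (xs ∷ʳ x) (ys ∷ʳ y) ≡ zipWith f xs ys ∷ʳ f x y
zipWith-∷ʳ f []       []       x y = refl
zipWith-∷ʳ f (a ∷ xs) (b ∷ ys) x y = cong (f a b ∷_) (zipWith-∷ʳ f xs ys x y)

replicate-∷ʳ : ∀ {A : Set} n (x : A) → replicate n x ∷ʳ x ≡ x ∷ replicate n x
replicate-∷ʳ zero    x = refl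
replicate-∷ʳ (suc n) x = cong (x ∷_) (replicate-∷ʳ n x)

shift : ∀ {ℓ} → Vec Bool ℓ → Vec Bool ℓ
shift []       = []
shift (_ ∷ us) = us ∷ʳ false

shift-additive : ∀ {ℓ} (u v : Vec Bool ℓ) → shift (xorW u v) ≡ xorW (shift u) (shift v)
shift-additive []      []      = refl
shift-additive (_ ∷ u) (_ ∷ v) = sym (zipWith-∷ʳ _xor_ u v false false)

shift-∷ʳ : ∀ {ℓ} (u : Vec Bool ℓ) → shift (u ∷ʳ false) ≡ shift u ∷ʳ false
shift-∷ʳ []      = refl
shift-∷ʳ (_ ∷ _) = refl

iter-shift-zeros-one : ∀ j → iter j shift (zeros-one j) ≡ one-zeros j
iter-shift-zeros-one zero    = refl
iter-shift-zeros-one (suc j) = begin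
  iter (suc j) shift (false ∷ zeros-one j)
    ≡⟨ sym (iter-intertwine {f = shift} {h = shift} (λ _ → refl) j (false ∷ zeros-one j)) ⟩
  iter j shift (zeros-one j ∷ʳ false)
    ≡⟨ iter-intertwine {h = _∷ʳ false} shift-∷ʳ j (zeros-one j) ⟩
  iter j shift (zeros-one j) ∷ʳ false  ≡⟨ cong (_∷ʳ false) (iter-shift-zeros-one j) ⟩
  true ∷ (replicate j false ∷ʳ false)  ≡⟨ cong (true ∷_) (replicate-∷ʳ j false) ⟩
  one-zeros (suc j)                    ∎

eqb-refl : ∀ a → eqb a a ≡ true
eqb-refl true  = refl
eqb-refl false = refl

S-replicate : ∀ {ℓ} a (u : Vec Bool ℓ) → S a (replicate ℓ a) u ≡ xorW u (shift u)
S-replicate a []            = refl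
S-replicate a (u ∷ [])      = cong (_∷ []) (sym (xor-identityʳ u))
S-replicate a (u ∷ u' ∷ us) =
  cong₂ _∷_ (cong (u xor_) (trans (cong (u' ∧_) (eqb-refl a)) (∧-identityʳ u')))
            (S-replicate a (u' ∷ us))

lemma7p9 : (j : ℕ) → j ≥ 1 → (ps : List ℕ) → Increasing ps → sumPow2 ps ≡ j →
             (a : Bool) →
             bigXor (map (λ I → iter (sumPow2 I) (S a (replicate (suc j) a)) (zeros-one j))
                         (subsets ps))
               ≡ one-zeros j
lemma7p9 j _ ps _ ps-sum a = begin
  bigXor (map (λ I → iter (sumPow2 I) (S a (replicate (suc j) a)) x) (subsets ps))
    ≡⟨ cong bigXor (map-cong (λ I → iter-cong (S-replicate a) (sumPow2 I) x) (subsets ps)) ⟩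
  ⨁ (map (λ I → iter (sumPow2 I) (1⊕ shift) x) (subsets ps))
    ≡⟨ ⨁-subsets-1⊕ shift-additive ps x ⟩
  iter (sumPow2 ps) shift x   ≡⟨ cong (λ k → iter k shift x) ps-sum ⟩
  iter j shift x              ≡⟨ iter-shift-zeros-one j ⟩
  one-zeros j                 ∎
  where
  open WordGroup (suc j)
  x = zeros-one j
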